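{- For integers $j\ge 0$ and $n$, let $D_j(n)=f_4\big(\sum_{i=0}^{j-1}2\cdot4^i+n\big)-b_4(n)$ (so $D_0(n)=f_4(n)-b_4(n)$). Then for every $j\ge 1$ and every integer $n$, $$D_j(n)=\begin{cases} D_{j-1}\!\left(\frac{n-k}{4}\right), & \text{if } n\equiv k\pmod 4 \text{ with } k\in\{ -1,0,1\},\\[2pt] D_{j-1}\!\left(\frac{n+2}{4}\right)+D_{j-1}\!\left(\frac{n-2}{4}\right), & \text{if } n\equiv 2\pmod 4.\end{cases}$$
   Context: For an integer $n$, a hyperquaternary representation of $n$ is an expression $n=\sum_{i\ge 0}\epsilon_i 4^i$ with finitely many nonzero $\epsilon_i$ and all $\epsilon_i\in\{0,1,2,3,4\}$; $f_4(n)$ denotes the number of such representations (so $f_4(n)=0$ for $n<0$). A balanced quaternary representation of $n$ is such an expression with all $\epsilon_i\in\{ -2,-1,0,1,2\}$; $b_4(n)$ denotes the number of such representations. Representations differing only by leading zeros are identified. -}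

module Defs where

open import Data.Nat as ℕ using (ℕ; zero; suc)
open import Data.Integer using (ℤ; +_; -[1+_]; _+_; _*_; _-_; -_; ∣_∣; _^_)
import Data.Integer.Properties as ℤP
open import Data.List using (List; []; _∷_; concatMap; map; filter; length)
open import Relation.Binary.PropositionalEquality using (_≡_)

val : List ℤ → ℤ
val []       = + 0
val (d ∷ ds) = d + + 4 * val ds

words : List ℤ → ℕ → List (List ℤ)
words ds zero    = [] ∷ []
words ds (suc L) = concatMap (λ d → map (d ∷_) (words ds L)) ds

-- A representation is padded with leading
-- zeros to the fixed length ∣n∣+1; every representation of n (for both digit
-- alphabets used below) has at most ∣n∣+1 digits after removing leading zeros,
-- so this counts each representation exactly once.
countReps : List ℤ → ℤ → ℕ
countReps ds n = length (filter (λ w → val w ℤP.≟ n) (words ds (suc ∣ n ∣)))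

hyperDigits : List ℤ
hyperDigits = + 0 ∷ + 1 ∷ + 2 ∷ + 3 ∷ + 4 ∷ []

balDigits : List ℤ
balDigits = - + 2 ∷ - + 1 ∷ + 0 ∷ + 1 ∷ + 2 ∷ []

-- f₄(n): number of hyperquaternary representations (0 for n < 0 automatically)
f4 : ℤ → ℕ
f4 = countReps hyperDigits

b4 : ℤ → ℕ
b4 = countReps balDigits

S : ℕ → ℤ
S zero    = + 0
S (suc j) = S j + + 2 * (+ 4) ^ j

D : ℕ → ℤ → ℤ
D j n = + f4 (S j + n) - + b4 n

{-# OPTIONS --safe #-}
module Submission where

-- A representation of 4a + r with units digit d exists only when 4 ∣ r - d, and
-- then the remaining digits represent a + (r - d)/4. Among the digits 0,…,4 the
-- residues 1, 2, 3 are each hit by a single digit and the residue 0 by both 0 and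
-- 4; among the balanced digits -2,…,2 the residues -1, 0, 1 are hit once and 2 by
-- both ±2. Since S (j+1) = 2 + 4 S j, we have S (j+1) + 4m + k = 4 (S j + m) + 2 + k,
-- which turns these digit counts into the recursion for D. The only technical
-- point is that countReps counts words padded to length ∣n∣ + 1: the number of
-- words of length L with value n does not depend on L once L ≥ ∣n∣.

open import Defs
open import Data.Nat using (ℕ; zero; suc; _≤_; _≤′_; s≤s)
import Data.Nat as ℕ
import Data.Nat.Properties as ℕP
open import Data.Nat.ListAction using (sum)
open import Data.Integer using (ℤ; +_; -[1+_]; _+_; _*_; _-_; -_; ∣_∣; _^_)
import Data.Integer.Properties as ℤP
open import Data.Integer.Divisibility.Signed using (_∣_; _∣?_; divides)
import Data.Integer.Tactic.RingSolver as ℤSolver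
open import Data.List using (List; []; _∷_; _++_; concatMap; map; filter; length)
open import Data.List.Properties using (filter-++; filter-≐; filter-none; length-++; map-cong-local)
import Data.List.Relation.Unary.All as All
open import Data.Product using (_×_; _,_)
open import Data.Sum using (_⊎_; inj₁; inj₂)
open import Function using (_∘_)
open import Level using (0ℓ)
open import Relation.Nullary using (¬_; yes; no)
open import Relation.Nullary.Decidable using (from-yes)
open import Relation.Unary using (Pred; Decidable)
open import Relation.Binary.PropositionalEquality
  using (_≡_; refl; sym; trans; cong; cong₂; module ≡-Reasoning)

module _ {A B : Set} {P : Pred B 0ℓ} (P? : Decidable P) where

  length-filter-map : ∀ (f : A → B) xs →
    length (filter P? (map f xs)) ≡ length (filter (P? ∘ f) xs)
  length-filter-map f []       = refl
  length-filter-map f (x ∷ xs) with P? (f x)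
  ... | yes _ = cong suc (length-filter-map f xs)
  ... | no  _ = length-filter-map f xs

  length-filter-concatMap : ∀ (f : A → List B) xs →
    length (filter P? (concatMap f xs)) ≡ sum (map (length ∘ filter P? ∘ f) xs)
  length-filter-concatMap f []       = refl
  length-filter-concatMap f (x ∷ xs) = begin
    length (filter P? (f x ++ concatMap f xs))
      ≡⟨ cong length (filter-++ P? (f x) (concatMap f xs)) ⟩
    length (filter P? (f x) ++ filter P? (concatMap f xs))
      ≡⟨ length-++ (filter P? (f x)) ⟩
    length (filter P? (f x)) ℕ.+ length (filter P? (concatMap f xs))
      ≡⟨ cong (length (filter P? (f x)) ℕ.+_) (length-filter-concatMap f xs) ⟩
    sum (map (length ∘ filter P? ∘ f) (x ∷ xs)) ∎
    where open ≡-Reasoning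

sum-map-cong-All : ∀ {A : Set} {P : Pred A 0ℓ} {f g : A → ℕ} {xs} →
  All.All P xs → (∀ x → P x → f x ≡ g x) → sum (map f xs) ≡ sum (map g xs)
sum-map-cong-All Pxs f≡g = cong sum (map-cong-local (All.map (f≡g _) Pxs))

d+4q≡n⇒n-d≡q*4 : ∀ {d q n} → d + + 4 * q ≡ n → n - d ≡ q * + 4
d+4q≡n⇒n-d≡q*4 {d} {q} refl = identity d q
  where
  identity : ∀ d q → (d + + 4 * q) - d ≡ q * + 4
  identity = ℤSolver.solve-∀

n-d≡q*4⇒d+4q≡n : ∀ {d q n} → n - d ≡ q * + 4 → d + + 4 * q ≡ n
n-d≡q*4⇒d+4q≡n {d} {q} {n} eq = begin
  d + + 4 * q    ≡⟨ cong (λ x → d + x) (ℤP.*-comm (+ 4) q) ⟩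
  d + q * + 4    ≡⟨ cong (λ x → d + x) (sym eq) ⟩
  d + (n - d)    ≡⟨ identity d n ⟩
  n              ∎
  where
  open ≡-Reasoning
  identity : ∀ d n → d + (n - d) ≡ n
  identity = ℤSolver.solve-∀

x≡q*4⇒4a+x≡[a+q]*4 : ∀ a q {x} → x ≡ q * + 4 → + 4 * a + x ≡ (a + q) * + 4
x≡q*4⇒4a+x≡[a+q]*4 a q refl = identity a q
  where
  identity : ∀ a q → + 4 * a + q * + 4 ≡ (a + q) * + 4
  identity = ℤSolver.solve-∀

4a+x≡q*4⇒x≡[q-a]*4 : ∀ a q {x} → + 4 * a + x ≡ q * + 4 → x ≡ (q - a) * + 4
4a+x≡q*4⇒x≡[q-a]*4 a q {x} eq = begin
  x                       ≡⟨ identity a x ⟩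
  (+ 4 * a + x) - a * + 4 ≡⟨ cong (_- a * + 4) eq ⟩
  q * + 4 - a * + 4       ≡⟨ identity′ q a ⟩
  (q - a) * + 4           ∎
  where
  open ≡-Reasoning
  identity : ∀ a x → x ≡ (+ 4 * a + x) - a * + 4
  identity = ℤSolver.solve-∀
  identity′ : ∀ q a → q * + 4 - a * + 4 ≡ (q - a) * + 4
  identity′ = ℤSolver.solve-∀

quotient-bound : ∀ {n d q} K → ∣ n ∣ ≤ 2 ℕ.+ K → ∣ d ∣ ≤ 4 → n - d ≡ q * + 4 →
  ∣ q ∣ ≤ suc K
quotient-bound {n} {d} {q} K ∣n∣≤ ∣d∣≤ eq =
  ℕP.≤-pred (ℕP.*-cancelʳ-< 4 ∣ q ∣ (2 ℕ.+ K) (begin-strict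
  ∣ q ∣ ℕ.* 4        ≡⟨ ℤP.abs-* q (+ 4) ⟨
  ∣ q * + 4 ∣        ≡⟨ cong ∣_∣ eq ⟨
  ∣ n - d ∣          ≤⟨ ℤP.∣i-j∣≤∣i∣+∣j∣ n d ⟩
  ∣ n ∣ ℕ.+ ∣ d ∣    ≤⟨ ℕP.+-mono-≤ ∣n∣≤ ∣d∣≤ ⟩
  2 ℕ.+ K ℕ.+ 4      ≡⟨ ℕP.+-comm (2 ℕ.+ K) 4 ⟩
  6 ℕ.+ K            <⟨ ℕP.+-monoʳ-≤ 7 (ℕP.m≤n⇒m≤1+n (ℕP.m≤m*n K 4)) ⟩
  (2 ℕ.+ K) ℕ.* 4    ∎))
  where open ℕP.≤-Reasoning

∣i∣≤1-elim : ∀ {P : ℤ → Set} → P (- + 1) → P (+ 0) → P (+ 1) → ∀ i → ∣ i ∣ ≤ 1 → P i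
∣i∣≤1-elim p₋ p₀ p₊ (+ 0)           _        = p₀
∣i∣≤1-elim p₋ p₀ p₊ (+ 1)           _        = p₊
∣i∣≤1-elim p₋ p₀ p₊ (+ suc (suc _)) (s≤s ())
∣i∣≤1-elim p₋ p₀ p₊ -[1+ 0 ]        _        = p₋
∣i∣≤1-elim p₋ p₀ p₊ -[1+ suc _ ]    (s≤s ())

count : List ℤ → ℕ → ℤ → ℕ
count ds L n = length (filter (λ w → val w ℤP.≟ n) (words ds L))

countWithUnitDigit : List ℤ → ℤ → ℕ → ℤ → ℕ
countWithUnitDigit ds d L n = length (filter (λ w → d + + 4 * val w ℤP.≟ n) (words ds L))

count-suc : ∀ ds L n → count ds (suc L) n ≡ sum (map (λ d → countWithUnitDigit ds d L n) ds)
count-suc ds L n = trans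
  (length-filter-concatMap (λ w → val w ℤP.≟ n) (λ d → map (d ∷_) (words ds L)) ds)
  (cong sum (map-cong-local (All.universal
    (λ d → length-filter-map (λ w → val w ℤP.≟ n) (d ∷_) (words ds L)) ds)))

countWithUnitDigit-divides : ∀ ds L d n {q} → n - d ≡ q * + 4 →
  countWithUnitDigit ds d L n ≡ count ds L q
countWithUnitDigit-divides ds L d n {q} eq =
  cong length (filter-≐ _ _ (to , from) (words ds L))
  where
  to : ∀ {v} → d + + 4 * v ≡ n → v ≡ q
  to {v} e = ℤP.*-cancelʳ-≡ v q (+ 4) (trans (sym (d+4q≡n⇒n-d≡q*4 e)) eq)
  from : ∀ {v} → v ≡ q → d + + 4 * v ≡ n
  from refl = n-d≡q*4⇒d+4q≡n eq

countWithUnitDigit-notDivides : ∀ ds L d n → ¬ (+ 4 ∣ n - d) →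
  countWithUnitDigit ds d L n ≡ 0
countWithUnitDigit-notDivides ds L d n 4∤n-d =
  cong length (filter-none (λ w → d + + 4 * val w ℤP.≟ n) (All.universal never (words ds L)))
  where
  never : ∀ w → ¬ (d + + 4 * val w ≡ n)
  never w e = 4∤n-d (divides (val w) (d+4q≡n⇒n-d≡q*4 e))

countWithUnitDigit-stable : ∀ ds K m → ∣ m ∣ ≤ 2 ℕ.+ K →
  (∀ q → ∣ q ∣ ≤ suc K → count ds (2 ℕ.+ K) q ≡ count ds (suc K) q) →
  ∀ d → ∣ d ∣ ≤ 4 → countWithUnitDigit ds d (2 ℕ.+ K) m ≡ countWithUnitDigit ds d (suc K) m
countWithUnitDigit-stable ds K m ∣m∣≤2+K stable d ∣d∣≤4 with + 4 ∣? m - d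
... | yes (divides q eq) = begin
  countWithUnitDigit ds d (2 ℕ.+ K) m ≡⟨ countWithUnitDigit-divides ds (2 ℕ.+ K) d m eq ⟩
  count ds (2 ℕ.+ K) q                ≡⟨ stable q (quotient-bound {m} {d} {q} K ∣m∣≤2+K ∣d∣≤4 eq) ⟩
  count ds (suc K) q                  ≡⟨ countWithUnitDigit-divides ds (suc K) d m eq ⟨
  countWithUnitDigit ds d (suc K) m   ∎
  where open ≡-Reasoning
... | no 4∤m-d = trans (countWithUnitDigit-notDivides ds (2 ℕ.+ K) d m 4∤m-d)
                       (sym (countWithUnitDigit-notDivides ds (suc K) d m 4∤m-d))

-- The number of representations of 4a + r whose units digit is d. The residue r is
-- kept apart from a so that the divisibility test computes for concrete r and d.
countRepsWithUnitDigit : List ℤ → ℤ → ℤ → ℤ → ℕ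
countRepsWithUnitDigit ds a r d with + 4 ∣? r - d
... | yes (divides q _) = countReps ds (a + q)
... | no _              = 0

-- For L ≥ 2 the stability of count at length L follows from that at length L - 1,
-- because the digits are at most 4 in absolute value; lengths 0 and 1 are checked
-- separately for each alphabet.
module _ (ds : List ℤ) (digits≤4 : All.All (λ d → ∣ d ∣ ≤ 4) ds)
         (count-stable₀ : count ds 1 (+ 0) ≡ count ds 0 (+ 0))
         (count-stable₁ : ∀ m → ∣ m ∣ ≤ 1 → count ds 2 m ≡ count ds 1 m) where

  count-stable : ∀ L m → ∣ m ∣ ≤ L → count ds (suc L) m ≡ count ds L m
  count-stable 0             (+ 0) _       = count-stable₀
  count-stable 1             m     ∣m∣≤1   = count-stable₁ m ∣m∣≤1
  count-stable (suc (suc K)) m     ∣m∣≤2+K = begin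
    count ds (3 ℕ.+ K) m
      ≡⟨ count-suc ds (2 ℕ.+ K) m ⟩
    sum (map (λ d → countWithUnitDigit ds d (2 ℕ.+ K) m) ds)
      ≡⟨ sum-map-cong-All digits≤4
           (countWithUnitDigit-stable ds K m ∣m∣≤2+K (count-stable (suc K))) ⟩
    sum (map (λ d → countWithUnitDigit ds d (suc K) m) ds)
      ≡⟨ count-suc ds (suc K) m ⟨
    count ds (2 ℕ.+ K) m ∎
    where open ≡-Reasoning

  count-stable-≤′ : ∀ {m L} → ∣ m ∣ ≤′ L → count ds L m ≡ count ds ∣ m ∣ m
  count-stable-≤′ ℕ.≤′-refl            = refl
  count-stable-≤′ (ℕ.≤′-step ∣m∣≤′L) =
    trans (count-stable _ _ (ℕP.≤′⇒≤ ∣m∣≤′L)) (count-stable-≤′ ∣m∣≤′L)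

  count≡countReps : ∀ {m L} → ∣ m ∣ ≤ L → count ds L m ≡ countReps ds m
  count≡countReps ∣m∣≤L =
    trans (count-stable-≤′ (ℕP.≤⇒≤′ ∣m∣≤L)) (sym (count-stable-≤′ (ℕ.≤′-step ℕ.≤′-refl)))

  countReps-unitDigit : ∀ a r →
    countReps ds (+ 4 * a + r) ≡ sum (map (countRepsWithUnitDigit ds a r) ds)
  countReps-unitDigit a r = begin
    countReps ds n
      ≡⟨ count-stable (suc ∣ n ∣) n (ℕP.n≤1+n _) ⟨
    count ds (2 ℕ.+ ∣ n ∣) n
      ≡⟨ count-suc ds (suc ∣ n ∣) n ⟩
    sum (map (λ d → countWithUnitDigit ds d (suc ∣ n ∣) n) ds)
      ≡⟨ sum-map-cong-All digits≤4 unitDigit ⟩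
    sum (map (countRepsWithUnitDigit ds a r) ds) ∎
    where
    open ≡-Reasoning
    n : ℤ
    n = + 4 * a + r
    n-d≡4a+[r-d] : ∀ d → n - d ≡ + 4 * a + (r - d)
    n-d≡4a+[r-d] d = ℤP.+-assoc (+ 4 * a) r (- d)
    unitDigit : ∀ d → ∣ d ∣ ≤ 4 →
      countWithUnitDigit ds d (suc ∣ n ∣) n ≡ countRepsWithUnitDigit ds a r d
    unitDigit d ∣d∣≤4 with + 4 ∣? r - d
    ... | yes (divides q eq) = begin
      countWithUnitDigit ds d (suc ∣ n ∣) n
        ≡⟨ countWithUnitDigit-divides ds (suc ∣ n ∣) d n n-d≡[a+q]*4 ⟩
      count ds (suc ∣ n ∣) (a + q)
        ≡⟨ count≡countReps ∣a+q∣≤1+∣n∣ ⟩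
      countReps ds (a + q) ∎
      where
      n-d≡[a+q]*4 : n - d ≡ (a + q) * + 4
      n-d≡[a+q]*4 = trans (n-d≡4a+[r-d] d) (x≡q*4⇒4a+x≡[a+q]*4 a q eq)
      ∣a+q∣≤1+∣n∣ : ∣ a + q ∣ ≤ suc ∣ n ∣
      ∣a+q∣≤1+∣n∣ = quotient-bound {n} {d} {a + q} ∣ n ∣ (ℕP.m≤n+m ∣ n ∣ 2) ∣d∣≤4 n-d≡[a+q]*4
    ... | no 4∤r-d = countWithUnitDigit-notDivides ds (suc ∣ n ∣) d n λ where
      (divides q eq) → 4∤r-d
        (divides (q - a) (4a+x≡q*4⇒x≡[q-a]*4 a q (trans (sym (n-d≡4a+[r-d] d)) eq)))

countReps-+0 : ∀ ds a → countReps ds (a + + 0) ℕ.+ 0 ≡ countReps ds a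
countReps-+0 ds a = trans (ℕP.+-identityʳ _) (cong (countReps ds) (ℤP.+-identityʳ a))

f4-unitDigit : ∀ a r →
  f4 (+ 4 * a + r) ≡ sum (map (countRepsWithUnitDigit hyperDigits a r) hyperDigits)
f4-unitDigit = countReps-unitDigit hyperDigits
  (from-yes (All.all? (λ d → ∣ d ∣ ℕ.≤? 4) hyperDigits)) refl (∣i∣≤1-elim refl refl refl)

b4-unitDigit : ∀ a r →
  b4 (+ 4 * a + r) ≡ sum (map (countRepsWithUnitDigit balDigits a r) balDigits)
b4-unitDigit = countReps-unitDigit balDigits
  (from-yes (All.all? (λ d → ∣ d ∣ ℕ.≤? 4) balDigits)) refl (∣i∣≤1-elim refl refl refl)

-- In the next four lemmas the digit sum is evaluated by computation: only the digits
-- congruent to the residue contribute.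
f4[4a+2+k]≡f4[a] : ∀ a {k} → k ≡ - + 1 ⊎ k ≡ + 0 ⊎ k ≡ + 1 →
  f4 (+ 4 * a + (+ 2 + k)) ≡ f4 a
f4[4a+2+k]≡f4[a] a (inj₁ refl)        = trans (f4-unitDigit a (+ 1)) (countReps-+0 hyperDigits a)
f4[4a+2+k]≡f4[a] a (inj₂ (inj₁ refl)) = trans (f4-unitDigit a (+ 2)) (countReps-+0 hyperDigits a)
f4[4a+2+k]≡f4[a] a (inj₂ (inj₂ refl)) = trans (f4-unitDigit a (+ 3)) (countReps-+0 hyperDigits a)

f4[4a+4]≡f4[a+1]+f4[a] : ∀ a → f4 (+ 4 * a + + 4) ≡ f4 (a + + 1) ℕ.+ f4 a
f4[4a+4]≡f4[a+1]+f4[a] a =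
  trans (f4-unitDigit a (+ 4)) (cong (f4 (a + + 1) ℕ.+_) (countReps-+0 hyperDigits a))

b4[4a+k]≡b4[a] : ∀ a {k} → k ≡ - + 1 ⊎ k ≡ + 0 ⊎ k ≡ + 1 → b4 (+ 4 * a + k) ≡ b4 a
b4[4a+k]≡b4[a] a (inj₁ refl)        = trans (b4-unitDigit a (- + 1)) (countReps-+0 balDigits a)
b4[4a+k]≡b4[a] a (inj₂ (inj₁ refl)) = trans (b4-unitDigit a (+ 0)) (countReps-+0 balDigits a)
b4[4a+k]≡b4[a] a (inj₂ (inj₂ refl)) = trans (b4-unitDigit a (+ 1)) (countReps-+0 balDigits a)

b4[4a+2]≡b4[a+1]+b4[a] : ∀ a → b4 (+ 4 * a + + 2) ≡ b4 (a + + 1) ℕ.+ b4 a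
b4[4a+2]≡b4[a+1]+b4[a] a =
  trans (b4-unitDigit a (+ 2)) (cong (b4 (a + + 1) ℕ.+_) (countReps-+0 balDigits a))

S-suc : ∀ j → S (suc j) ≡ + 2 + + 4 * S j
S-suc zero    = refl
S-suc (suc j) =
  trans (cong (_+ + 2 * (+ 4 * (+ 4) ^ j)) (S-suc j)) (identity (S j) ((+ 4) ^ j))
  where
  identity : ∀ s x → (+ 2 + + 4 * s) + + 2 * (+ 4 * x) ≡ + 2 + + 4 * (s + + 2 * x)
  identity = ℤSolver.solve-∀

S-suc-+ : ∀ j m k → S (suc j) + (+ 4 * m + k) ≡ + 4 * (S j + m) + (+ 2 + k)
S-suc-+ j m k = trans (cong (_+ (+ 4 * m + k)) (S-suc j)) (identity (S j) m k)
  where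
  identity : ∀ s m k → (+ 2 + + 4 * s) + (+ 4 * m + k) ≡ + 4 * (s + m) + (+ 2 + k)
  identity = ℤSolver.solve-∀

D-suc-4m+k : ∀ j m {k} → k ≡ - + 1 ⊎ k ≡ + 0 ⊎ k ≡ + 1 →
  D (suc j) (+ 4 * m + k) ≡ D j m
D-suc-4m+k j m {k} k∈ = cong₂ (λ x y → + x - + y)
  (trans (cong f4 (S-suc-+ j m k)) (f4[4a+2+k]≡f4[a] (S j + m) k∈))
  (b4[4a+k]≡b4[a] m k∈)

D-suc-4m+2 : ∀ j m → D (suc j) (+ 4 * m + + 2) ≡ D j (m + + 1) + D j m
D-suc-4m+2 j m = begin
  + f4 (S (suc j) + (+ 4 * m + + 2)) - + b4 (+ 4 * m + + 2)
    ≡⟨ cong (λ x → + f4 x - + b4 (+ 4 * m + + 2)) (S-suc-+ j m (+ 2)) ⟩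
  + f4 (+ 4 * (S j + m) + + 4) - + b4 (+ 4 * m + + 2)
    ≡⟨ cong₂ (λ x y → + x - + y) (f4[4a+4]≡f4[a+1]+f4[a] (S j + m)) (b4[4a+2]≡b4[a+1]+b4[a] m) ⟩
  + (f4 (S j + m + + 1) ℕ.+ f4 (S j + m)) - + (b4 (m + + 1) ℕ.+ b4 m)
    ≡⟨ cong₂ _-_ (ℤP.pos-+ (f4 (S j + m + + 1)) _) (ℤP.pos-+ (b4 (m + + 1)) _) ⟩
  (+ f4 (S j + m + + 1) + + f4 (S j + m)) - (+ b4 (m + + 1) + + b4 m)
    ≡⟨ identity (+ f4 (S j + m + + 1)) (+ f4 (S j + m)) (+ b4 (m + + 1)) (+ b4 m) ⟩
  (+ f4 (S j + m + + 1) - + b4 (m + + 1)) + D j m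
    ≡⟨ cong (λ x → (+ f4 x - + b4 (m + + 1)) + D j m) (ℤP.+-assoc (S j) m (+ 1)) ⟩
  D j (m + + 1) + D j m ∎
  where
  open ≡-Reasoning
  identity : ∀ x y u v → (x + y) - (u + v) ≡ (x - u) + (y - v)
  identity = ℤSolver.solve-∀

lemma3p2 : (j : ℕ) (n : ℤ) →
    ((k m : ℤ) → (k ≡ - + 1 ⊎ k ≡ + 0 ⊎ k ≡ + 1) → n ≡ + 4 * m + k →
      D (suc j) n ≡ D j m)
    × ((m : ℤ) → n ≡ + 4 * m + + 2 →
      D (suc j) n ≡ D j (m + + 1) + D j m)
lemma3p2 j n =
    (λ k m k∈ n≡4m+k → trans (cong (D (suc j)) n≡4m+k) (D-suc-4m+k j m k∈))
  , (λ m n≡4m+2 → trans (cong (D (suc j)) n≡4m+2) (D-suc-4m+2 j m))
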